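{- Let $e\geq 2$ be an integer and let $O(2e+1,e,e+1)$ be the doubled Odd graph. Then $\mu(O(2e+1,e,e+1))\leq 2e+1$.
   Context: For a connected graph $\Gamma$ with distance function $d$, a resolving set is a set of vertices $S=\{v_1,\ldots,v_k\}$ such that for any two distinct vertices $u,v$ the vectors $(d(u,v_1),\ldots,d(u,v_k))$ and $(d(v,v_1),\ldots,d(v,v_k))$ differ. The metric dimension $\mu(\Gamma)$ is the smallest size of a resolving set of $\Gamma$. The doubled Odd graph $O(2e+1,e,e+1)$ is the bipartite graph whose vertex set is the union of the set of $e$-element subsets and the set of $(e+1)$-element subsets of $\{1,\ldots,2e+1\}$, where an $e$-subset $P$ and an $(e+1)$-subset $Q$ are adjacent iff $P\subseteq Q$ (and there are no other edges). -}

module Defs where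

open import Data.Nat using (ℕ; zero; suc; _+_; _*_; _≤_)
open import Data.Fin.Subset using (Subset; ∣_∣; _⊆_)
open import Data.List using (List; length)
open import Data.List.Membership.Propositional using (_∈_)
open import Data.Product using (Σ; _×_; _,_; ∃; ∃-syntax)
open import Data.Sum using (_⊎_)
open import Relation.Binary.PropositionalEquality using (_≡_; _≢_)

data Walk {V : Set} (Adj : V → V → Set) : V → V → ℕ → Set where
  here : ∀ {u} → Walk Adj u u zero
  step : ∀ {u v w k} → Adj u v → Walk Adj v w k → Walk Adj u w (suc k)

Dist : {V : Set} (Adj : V → V → Set) → V → V → ℕ → Set
Dist Adj u v k = Walk Adj u v k × (∀ m → Walk Adj u v m → k ≤ m)

Resolving : {V : Set} (Adj : V → V → Set) → List V → Set
Resolving {V} Adj S =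
  (u v : V) → u ≢ v →
  ∃[ s ] (s ∈ S × ∃[ a ] ∃[ b ] (Dist Adj u s a × Dist Adj v s b × a ≢ b))

MetricDimensionAtMost : {V : Set} (Adj : V → V → Set) → ℕ → Set
MetricDimensionAtMost {V} Adj m = ∃[ S ] (length S ≤ m × Resolving Adj S)

-- Ground set {1,…,2e+1} is represented by Fin (2e+1).
OddVertex : ℕ → Set
OddVertex e = Σ (Subset (suc (2 * e))) (λ s → ∣ s ∣ ≡ e ⊎ ∣ s ∣ ≡ suc e)

OddAdj : (e : ℕ) → OddVertex e → OddVertex e → Set
OddAdj e (P , _) (Q , _) =
  (∣ P ∣ ≡ e × ∣ Q ∣ ≡ suc e × P ⊆ Q) ⊎ (∣ Q ∣ ≡ e × ∣ P ∣ ≡ suc e × Q ⊆ P)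

module Submission where

-- A vertex is identified with its characteristic vector in {0,1}^(2e+1).
-- (1) The graph distance between two vertices is the Hamming distance of
--     their vectors: an edge changes exactly one coordinate, and from any
--     vertex there is a neighbour one coordinate closer to any other vertex
--     (add a missing element on level e, drop a superfluous one on level e+1).
-- (2) hamming(A,B) ≡ |A| + |B| (mod 2), so the level of a vertex is
--     determined by its distance to any fixed vertex.
-- (3) Let w₀,…,wₙ be the prefix flips of a vector v (w_k is v with its first
--     k coordinates complemented).  Two vectors whose distances to the w_k
--     differ by a constant offset coincide: w_k and w_{k+1} differ only at
--     coordinate k, and the change of distance there reveals that coordinate.
-- The resolving set consists of the 2e+1 vectors 0·w_k, where w_k runs over
-- the prefix flips of the alternating vector 0101…01 of length 2e; these lie
-- alternately on levels e and e+1.  Two vertices equidistant from all of them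
-- agree off the first coordinate by (3) and on the first coordinate by (2).

open import Defs
open import Data.Bool using (Bool; true; false; not)
open import Data.Empty using (⊥; ⊥-elim)
open import Data.Fin using (Fin; zero; suc)
open import Data.Fin.Subset using (Subset; ∣_∣; _⊆_; _∩_)
open import Data.Fin.Subset.Properties using (⊆-refl; drop-∷-⊆; out⊆; s⊆s)
open import Data.List using (List; []; _∷_; length; map)
open import Data.List.Membership.Propositional using (find)
open import Data.List.Properties using (length-map)
open import Data.List.Relation.Unary.All using (All; []; _∷_; toList)
import Data.List.Relation.Unary.All as All
open import Data.List.Relation.Unary.All.Properties using (map⁺; map⁻; ¬All⇒Any¬)
open import Data.Nat using (ℕ; zero; suc; _+_; _*_; _≤_; z≤n; s≤s)
open import Data.Nat.Properties
open import Algebra.Properties.CommutativeSemigroup +-commutativeSemigroup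
  using (interchange)
open import Data.Product using (∃-syntax; _×_; _,_; proj₁; proj₂)
open import Data.Sum using (_⊎_; inj₁; inj₂)
open import Data.Vec using (Vec; []; _∷_; lookup; updateAt; here)
open import Relation.Binary.PropositionalEquality

bitDist : Bool → Bool → ℕ
bitDist true  true  = 0
bitDist false false = 0
bitDist true  false = 1
bitDist false true  = 1

hamming : ∀ {n} → Vec Bool n → Vec Bool n → ℕ
hamming []      []      = 0
hamming (x ∷ u) (y ∷ v) = bitDist x y + hamming u v

bitDist-sym : ∀ x y → bitDist x y ≡ bitDist y x
bitDist-sym true  true  = refl
bitDist-sym true  false = refl
bitDist-sym false true  = refl
bitDist-sym false false = refl

hamming-sym : ∀ {n} (u v : Vec Bool n) → hamming u v ≡ hamming v u
hamming-sym []      []      = refl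
hamming-sym (x ∷ u) (y ∷ v) = cong₂ _+_ (bitDist-sym x y) (hamming-sym u v)

hamming-self : ∀ {n} (u : Vec Bool n) → hamming u u ≡ 0
hamming-self []          = refl
hamming-self (true ∷ u)  = hamming-self u
hamming-self (false ∷ u) = hamming-self u

hamming≡0⇒≡ : ∀ {n} (u v : Vec Bool n) → hamming u v ≡ 0 → u ≡ v
hamming≡0⇒≡ []          []          _  = refl
hamming≡0⇒≡ (true ∷ u)  (true ∷ v)  eq = cong (true ∷_) (hamming≡0⇒≡ u v eq)
hamming≡0⇒≡ (false ∷ u) (false ∷ v) eq = cong (false ∷_) (hamming≡0⇒≡ u v eq)
hamming≡0⇒≡ (true ∷ u)  (false ∷ v) ()
hamming≡0⇒≡ (false ∷ u) (true ∷ v)  ()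

bitDist-triangle : ∀ x y z → bitDist x z ≤ bitDist x y + bitDist y z
bitDist-triangle true  true  true  = z≤n
bitDist-triangle true  true  false = s≤s z≤n
bitDist-triangle true  false true  = z≤n
bitDist-triangle true  false false = s≤s z≤n
bitDist-triangle false true  true  = s≤s z≤n
bitDist-triangle false true  false = z≤n
bitDist-triangle false false true  = s≤s z≤n
bitDist-triangle false false false = z≤n

hamming-triangle : ∀ {n} (u v w : Vec Bool n) →
                   hamming u w ≤ hamming u v + hamming v w
hamming-triangle []      []      []      = z≤n
hamming-triangle (x ∷ u) (y ∷ v) (z ∷ w) = begin
  bitDist x z + hamming u w
    ≤⟨ +-mono-≤ (bitDist-triangle x y z) (hamming-triangle u v w) ⟩
  (bitDist x y + bitDist y z) + (hamming u v + hamming v w)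
    ≡⟨ interchange (bitDist x y) (bitDist y z) (hamming u v) (hamming v w) ⟩
  (bitDist x y + hamming u v) + (bitDist y z + hamming v w) ∎
  where open ≤-Reasoning

⊆⇒hamming+size : ∀ {n} (P Q : Subset n) → P ⊆ Q → hamming P Q + ∣ P ∣ ≡ ∣ Q ∣
⊆⇒hamming+size []          []          _   = refl
⊆⇒hamming+size (true ∷ P)  (true ∷ Q)  P⊆Q =
  trans (+-suc (hamming P Q) ∣ P ∣) (cong suc (⊆⇒hamming+size P Q (drop-∷-⊆ P⊆Q)))
⊆⇒hamming+size (true ∷ P)  (false ∷ Q) P⊆Q with P⊆Q here
... | ()
⊆⇒hamming+size (false ∷ P) (true ∷ Q)  P⊆Q = cong suc (⊆⇒hamming+size P Q (drop-∷-⊆ P⊆Q))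
⊆⇒hamming+size (false ∷ P) (false ∷ Q) P⊆Q = ⊆⇒hamming+size P Q (drop-∷-⊆ P⊆Q)

⊆-size⇒hamming≡0 : ∀ {n} (P Q : Subset n) → P ⊆ Q → ∣ Q ∣ ≤ ∣ P ∣ → hamming P Q ≡ 0
⊆-size⇒hamming≡0 P Q P⊆Q ∣Q∣≤∣P∣ = n≤0⇒n≡0 (+-cancelʳ-≤ ∣ P ∣ (hamming P Q) 0
  (≤-trans (≤-reflexive (⊆⇒hamming+size P Q P⊆Q)) ∣Q∣≤∣P∣))

MissingOr⊆ : ∀ {n} → Vec Bool n → Vec Bool n → Set
MissingOr⊆ u w = (∃[ i ] (lookup u i ≡ false × lookup w i ≡ true)) ⊎ (w ⊆ u)

missingOr⊆ : ∀ {n} (u w : Vec Bool n) → MissingOr⊆ u w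
missingOr⊆ []      []      = inj₂ (λ ())
missingOr⊆ (x ∷ u) (y ∷ w) = extend x y (missingOr⊆ u w)
  where
  extend : ∀ x y → MissingOr⊆ u w → MissingOr⊆ (x ∷ u) (y ∷ w)
  extend false true  _                       = inj₁ (zero , refl , refl)
  extend x     y     (inj₁ (i , i∉u , i∈w)) = inj₁ (suc i , i∉u , i∈w)
  extend true  true  (inj₂ w⊆u)             = inj₂ (s⊆s w⊆u)
  extend true  false (inj₂ w⊆u)             = inj₂ (out⊆ w⊆u)
  extend false false (inj₂ w⊆u)             = inj₂ (s⊆s w⊆u)

toggle : ∀ {n} → Fin n → Vec Bool n → Vec Bool n
toggle i u = updateAt u i not

toggle-⊇ : ∀ {n} (i : Fin n) (u : Vec Bool n) → lookup u i ≡ false → u ⊆ toggle i u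
toggle-⊇ zero    (false ∷ u) _   = out⊆ ⊆-refl
toggle-⊇ (suc i) (x ∷ u)     i∉u = s⊆s (toggle-⊇ i u i∉u)

toggle-⊆ : ∀ {n} (i : Fin n) (u : Vec Bool n) → lookup u i ≡ true → toggle i u ⊆ u
toggle-⊆ zero    (true ∷ u) _   = out⊆ ⊆-refl
toggle-⊆ (suc i) (x ∷ u)    i∈u = s⊆s (toggle-⊆ i u i∈u)

toggle-size-grows : ∀ {n} (i : Fin n) (u : Vec Bool n) → lookup u i ≡ false →
                    ∣ toggle i u ∣ ≡ suc ∣ u ∣
toggle-size-grows zero    (false ∷ u) _   = refl
toggle-size-grows (suc i) (true ∷ u)  i∉u = cong suc (toggle-size-grows i u i∉u)
toggle-size-grows (suc i) (false ∷ u) i∉u = toggle-size-grows i u i∉u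

toggle-size-shrinks : ∀ {n} (i : Fin n) (u : Vec Bool n) → lookup u i ≡ true →
                      suc ∣ toggle i u ∣ ≡ ∣ u ∣
toggle-size-shrinks zero    (true ∷ u)  _   = refl
toggle-size-shrinks (suc i) (true ∷ u)  i∈u = cong suc (toggle-size-shrinks i u i∈u)
toggle-size-shrinks (suc i) (false ∷ u) i∈u = toggle-size-shrinks i u i∈u

toggle-closer : ∀ {n} (i : Fin n) (u w : Vec Bool n) → lookup u i ≡ not (lookup w i) →
                hamming u w ≡ suc (hamming (toggle i u) w)
toggle-closer zero    (true ∷ u)  (false ∷ w) _  = refl
toggle-closer zero    (false ∷ u) (true ∷ w)  _  = refl
toggle-closer zero    (true ∷ u)  (true ∷ w)  ()
toggle-closer zero    (false ∷ u) (false ∷ w) ()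
toggle-closer (suc i) (x ∷ u)     (y ∷ w)     eq =
  trans (cong (bitDist x y +_) (toggle-closer i u w eq)) (+-suc (bitDist x y) _)

hamming-parity : ∀ {n} (u v : Vec Bool n) → hamming u v + 2 * ∣ u ∩ v ∣ ≡ ∣ u ∣ + ∣ v ∣
hamming-parity []          []          = refl
hamming-parity (true ∷ u)  (true ∷ v)  = begin
  hamming u v + 2 * suc ∣ u ∩ v ∣   ≡⟨ cong (hamming u v +_) (*-suc 2 ∣ u ∩ v ∣) ⟩
  hamming u v + (2 + 2 * ∣ u ∩ v ∣) ≡⟨ +-suc (hamming u v) _ ⟩
  suc (hamming u v + suc (2 * ∣ u ∩ v ∣)) ≡⟨ cong suc (+-suc (hamming u v) _) ⟩
  2 + (hamming u v + 2 * ∣ u ∩ v ∣) ≡⟨ cong (2 +_) (hamming-parity u v) ⟩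
  2 + (∣ u ∣ + ∣ v ∣)               ≡⟨ cong suc (sym (+-suc ∣ u ∣ ∣ v ∣)) ⟩
  suc ∣ u ∣ + suc ∣ v ∣             ∎
  where open ≡-Reasoning
hamming-parity (true ∷ u)  (false ∷ v) = cong suc (hamming-parity u v)
hamming-parity (false ∷ u) (true ∷ v)  =
  trans (cong suc (hamming-parity u v)) (sym (+-suc ∣ u ∣ ∣ v ∣))
hamming-parity (false ∷ u) (false ∷ v) = hamming-parity u v

consecutive-sizes-separated : ∀ {n} (A A' B : Subset n) → ∣ A' ∣ ≡ suc ∣ A ∣ →
                              hamming A B ≢ hamming A' B
consecutive-sizes-separated A A' B size eq =
  even≢odd ∣ A' ∩ B ∣ ∣ A ∩ B ∣ (+-cancelˡ-≡ (hamming A B) _ _ (begin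
    hamming A B + 2 * ∣ A' ∩ B ∣       ≡⟨ cong (_+ 2 * ∣ A' ∩ B ∣) eq ⟩
    hamming A' B + 2 * ∣ A' ∩ B ∣      ≡⟨ hamming-parity A' B ⟩
    ∣ A' ∣ + ∣ B ∣                     ≡⟨ cong (_+ ∣ B ∣) size ⟩
    suc (∣ A ∣ + ∣ B ∣)                ≡⟨ cong suc (sym (hamming-parity A B)) ⟩
    suc (hamming A B + 2 * ∣ A ∩ B ∣)  ≡⟨ sym (+-suc (hamming A B) _) ⟩
    hamming A B + suc (2 * ∣ A ∩ B ∣)  ∎))
  where open ≡-Reasoning

size-determines-head : ∀ {n} (a a' : Bool) (As : Subset n) →
                       ∣ a ∷ As ∣ ≡ ∣ a' ∷ As ∣ → a ≡ a'
size-determines-head true  true  As _  = refl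
size-determines-head false false As _  = refl
size-determines-head true  false As eq = ⊥-elim (1+n≢n eq)
size-determines-head false true  As eq = ⊥-elim (1+n≢n (sym eq))

prefixFlips : ∀ {n} → Vec Bool n → List (Vec Bool n)
prefixFlips []       = [] ∷ []
prefixFlips (x ∷ xs) = (x ∷ xs) ∷ map (not x ∷_) (prefixFlips xs)

length-prefixFlips : ∀ {n} (v : Vec Bool n) → length (prefixFlips v) ≡ suc n
length-prefixFlips []      = refl
length-prefixFlips (x ∷ v) =
  cong suc (trans (length-map (not x ∷_) (prefixFlips v)) (length-prefixFlips v))

All-prefixFlips-head : ∀ {n} {P : Vec Bool n → Set} (v : Vec Bool n) →
                       All P (prefixFlips v) → P v
All-prefixFlips-head []      (p ∷ _) = p
All-prefixFlips-head (x ∷ v) (p ∷ _) = p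

offByOne-incompatible : ∀ c h c' h' → c + h ≡ c' + suc h' → c + suc h ≡ c' + h' → ⊥
offByOne-incompatible c h c' h' e₁ e₂ = n≢2+n (begin
  c' + h'             ≡⟨ sym e₂ ⟩
  c + suc h           ≡⟨ +-suc c h ⟩
  suc (c + h)         ≡⟨ cong suc e₁ ⟩
  suc (c' + suc h')   ≡⟨ cong suc (+-suc c' h') ⟩
  suc (suc (c' + h')) ∎)
  where
  open ≡-Reasoning
  n≢2+n : ∀ {m} → m ≢ suc (suc m)
  n≢2+n ()

-- A bit y is recovered from how its distance changes when the bit it is
-- compared with is complemented: the distance drops iff y differs from x.
bitDist-change-separates : ∀ c h c' h' x y y' →
  c + (bitDist y x + h) ≡ c' + (bitDist y' x + h') →
  c + (bitDist y (not x) + h) ≡ c' + (bitDist y' (not x) + h') → y ≡ y'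
bitDist-change-separates c h c' h' x true  true  _  _  = refl
bitDist-change-separates c h c' h' x false false _  _  = refl
bitDist-change-separates c h c' h' true  true  false e₁ e₂ = ⊥-elim (offByOne-incompatible c h c' h' e₁ e₂)
bitDist-change-separates c h c' h' false true  false e₁ e₂ = ⊥-elim (offByOne-incompatible c h c' h' e₂ e₁)
bitDist-change-separates c h c' h' true  false true  e₁ e₂ = ⊥-elim (offByOne-incompatible c h c' h' e₂ e₁)
bitDist-change-separates c h c' h' false false true  e₁ e₂ = ⊥-elim (offByOne-incompatible c h c' h' e₁ e₂)

prefixFlips-separate : ∀ {n} (v X Y : Vec Bool n) (c c' : ℕ) →
  All (λ w → c + hamming X w ≡ c' + hamming Y w) (prefixFlips v) → X ≡ Y
prefixFlips-separate []      []      []       c c' _ = refl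
prefixFlips-separate (x ∷ v) (y ∷ X) (y' ∷ Y) c c' (atV ∷ rest)
  with bitDist-change-separates c (hamming X v) c' (hamming Y v) x y y'
         atV (All-prefixFlips-head v (map⁻ rest))
... | refl = cong (y ∷_) (prefixFlips-separate v X Y (c + bitDist y (not x))
               (c' + bitDist y (not x)) (All.map reassociate (map⁻ rest)))
  where
  reassociate : ∀ {a b} → c + (bitDist y (not x) + a) ≡ c' + (bitDist y (not x) + b) →
                (c + bitDist y (not x)) + a ≡ (c' + bitDist y (not x)) + b
  reassociate {a} {b} eq =
    trans (+-assoc c _ a) (trans eq (sym (+-assoc c' _ b)))

alternating : ∀ n → Bool → Vec Bool n
alternating zero    b = []
alternating (suc n) b = b ∷ alternating n (not b)

alternating-size : ∀ e → ∣ alternating (2 * e) false ∣ ≡ e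
alternating-size zero    = refl
alternating-size (suc e) =
  trans (cong (λ n → ∣ alternating n false ∣) (*-suc 2 e)) (cong suc (alternating-size e))

InLayers : ∀ {n} → ℕ → Subset n → Set
InLayers m s = ∣ s ∣ ≡ m ⊎ ∣ s ∣ ≡ suc m

prefixFlips-alternating₀ : ∀ n →
  All (InLayers ∣ alternating n false ∣) (prefixFlips (alternating n false))
prefixFlips-alternating₁ : ∀ n →
  All (λ w → suc ∣ w ∣ ≡ ∣ alternating n true ∣ ⊎ ∣ w ∣ ≡ ∣ alternating n true ∣)
      (prefixFlips (alternating n true))
prefixFlips-alternating₀ zero    = inj₁ refl ∷ []
prefixFlips-alternating₀ (suc n) =
  inj₁ refl ∷ map⁺ (All.map (λ {w} → addTrue w) (prefixFlips-alternating₁ n))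
  where
  addTrue : ∀ w → suc ∣ w ∣ ≡ ∣ alternating n true ∣ ⊎ ∣ w ∣ ≡ ∣ alternating n true ∣ →
            InLayers ∣ alternating n true ∣ (true ∷ w)
  addTrue _ (inj₁ p) = inj₁ p
  addTrue _ (inj₂ p) = inj₂ (cong suc p)
prefixFlips-alternating₁ zero    = inj₂ refl ∷ []
prefixFlips-alternating₁ (suc n) =
  inj₂ refl ∷ map⁺ (All.map (λ {w} → addFalse w) (prefixFlips-alternating₀ n))
  where
  addFalse : ∀ w → InLayers ∣ alternating n false ∣ w →
             suc ∣ false ∷ w ∣ ≡ suc ∣ alternating n false ∣ ⊎
             ∣ false ∷ w ∣ ≡ suc ∣ alternating n false ∣
  addFalse _ (inj₁ p) = inj₁ (cong suc p)
  addFalse _ (inj₂ p) = inj₂ p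

length-toList : ∀ {A : Set} {P : A → Set} {xs : List A} (ps : All P xs) →
                length (toList ps) ≡ length xs
length-toList []       = refl
length-toList (p ∷ ps) = cong suc (length-toList ps)

All-toList⁻ : ∀ {A : Set} {P R : A → Set} {xs : List A} (ps : All P xs) →
              All (λ s → R (proj₁ s)) (toList ps) → All R xs
All-toList⁻ []       []       = []
All-toList⁻ (p ∷ ps) (r ∷ rs) = r ∷ All-toList⁻ ps rs

module DoubledOdd (e : ℕ) where

  Ground : Set
  Ground = Subset (suc (2 * e))

  Vertex : Set
  Vertex = OddVertex e

  vertex-≡ : (u v : Vertex) → proj₁ u ≡ proj₁ v → u ≡ v
  vertex-≡ (A , p) (.A , q) refl = cong (A ,_) (layer-irrelevant p q)
    where
    layer-irrelevant : (p q : InLayers e A) → p ≡ q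
    layer-irrelevant (inj₁ a) (inj₁ b) = cong inj₁ (≡-irrelevant a b)
    layer-irrelevant (inj₂ a) (inj₂ b) = cong inj₂ (≡-irrelevant a b)
    layer-irrelevant (inj₁ a) (inj₂ b) = ⊥-elim (1+n≢n (trans (sym b) a))
    layer-irrelevant (inj₂ a) (inj₁ b) = ⊥-elim (1+n≢n (trans (sym a) b))

  layer-lower : ∀ {W : Ground} → InLayers e W → e ≤ ∣ W ∣
  layer-lower (inj₁ p) = ≤-reflexive (sym p)
  layer-lower (inj₂ p) = ≤-trans (n≤1+n e) (≤-reflexive (sym p))

  layer-upper : ∀ {W : Ground} → InLayers e W → ∣ W ∣ ≤ suc e
  layer-upper (inj₁ p) = ≤-trans (≤-reflexive p) (n≤1+n e)
  layer-upper (inj₂ p) = ≤-reflexive p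

  dist : Vertex → Vertex → ℕ
  dist u v = hamming (proj₁ u) (proj₁ v)

  adjacent⇒dist≡1 : ∀ {u v} → OddAdj e u v → dist u v ≡ 1
  adjacent⇒dist≡1 {P , _} {Q , _} (inj₁ (∣P∣≡e , ∣Q∣≡1+e , P⊆Q)) =
    +-cancelʳ-≡ e _ _
      (trans (cong (hamming P Q +_) (sym ∣P∣≡e)) (trans (⊆⇒hamming+size P Q P⊆Q) ∣Q∣≡1+e))
  adjacent⇒dist≡1 {P , _} {Q , _} (inj₂ (∣Q∣≡e , ∣P∣≡1+e , Q⊆P)) =
    trans (hamming-sym P Q) (+-cancelʳ-≡ e _ _
      (trans (cong (hamming Q P +_) (sym ∣Q∣≡e)) (trans (⊆⇒hamming+size Q P Q⊆P) ∣P∣≡1+e)))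

  walk-length≥dist : ∀ {u w m} → Walk (OddAdj e) u w m → dist u w ≤ m
  walk-length≥dist {u} here = ≤-reflexive (hamming-self (proj₁ u))
  walk-length≥dist {u} {w} (step {v = v} u~v v⇝w) = begin
    dist u w            ≤⟨ hamming-triangle (proj₁ u) (proj₁ v) (proj₁ w) ⟩
    dist u v + dist v w ≡⟨ cong (_+ dist v w) (adjacent⇒dist≡1 {u} {v} u~v) ⟩
    suc (dist v w)      ≤⟨ s≤s (walk-length≥dist v⇝w) ⟩
    suc _               ∎
    where open ≤-Reasoning

  -- Every vertex other than w has a neighbour one step closer to w: on level
  -- e add an element of w missing from u, on level e+1 drop an element of u
  -- outside w.  If no such element exists, u and w are nested with sizes
  -- forcing u ≡ w.
  stepTowards : ∀ {k} (u w : Vertex) → dist u w ≡ suc k →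
                ∃[ v ] (OddAdj e u v × dist v w ≡ k)
  stepTowards (A , inj₁ ∣A∣≡e) (W , W-layer) d≡1+k with missingOr⊆ A W
  ... | inj₁ (i , i∉A , i∈W) =
    (toggle i A , inj₂ grown) ,
    inj₁ (∣A∣≡e , grown , toggle-⊇ i A i∉A) ,
    suc-injective (trans (sym (toggle-closer i A W (trans i∉A (sym (cong not i∈W))))) d≡1+k)
    where
    grown : ∣ toggle i A ∣ ≡ suc e
    grown = trans (toggle-size-grows i A i∉A) (cong suc ∣A∣≡e)
  ... | inj₂ W⊆A = ⊥-elim (0≢1+n (begin
    0              ≡⟨ sym (⊆-size⇒hamming≡0 W A W⊆A
                           (≤-trans (≤-reflexive ∣A∣≡e) (layer-lower {W} W-layer))) ⟩
    hamming W A    ≡⟨ hamming-sym W A ⟩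
    hamming A W    ≡⟨ d≡1+k ⟩
    suc _          ∎))
    where open ≡-Reasoning
  stepTowards (A , inj₂ ∣A∣≡1+e) (W , W-layer) d≡1+k with missingOr⊆ W A
  ... | inj₁ (i , i∉W , i∈A) =
    (toggle i A , inj₁ shrunk) ,
    inj₂ (shrunk , ∣A∣≡1+e , toggle-⊆ i A i∈A) ,
    suc-injective (trans (sym (toggle-closer i A W (trans i∈A (sym (cong not i∉W))))) d≡1+k)
    where
    shrunk : ∣ toggle i A ∣ ≡ e
    shrunk = suc-injective (trans (toggle-size-shrinks i A i∈A) ∣A∣≡1+e)
  ... | inj₂ A⊆W = ⊥-elim (0≢1+n (begin
    0              ≡⟨ sym (⊆-size⇒hamming≡0 A W A⊆W
                           (≤-trans (layer-upper {W} W-layer) (≤-reflexive (sym ∣A∣≡1+e)))) ⟩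
    hamming A W    ≡⟨ d≡1+k ⟩
    suc _          ∎))
    where open ≡-Reasoning

  walkOfLength : ∀ k (u w : Vertex) → dist u w ≡ k → Walk (OddAdj e) u w k
  walkOfLength zero u w d≡0 =
    subst (λ x → Walk (OddAdj e) u x 0) (vertex-≡ u w (hamming≡0⇒≡ _ _ d≡0)) here
  walkOfLength (suc k) u w d≡1+k with stepTowards u w d≡1+k
  ... | v , u~v , d≡k = step u~v (walkOfLength k v w d≡k)

  isDist : (u w : Vertex) → Dist (OddAdj e) u w (dist u w)
  isDist u w = walkOfLength _ u w refl , λ m u⇝w → walk-length≥dist u⇝w

  sameLevel : ∀ {A A' B : Ground} → InLayers e A → InLayers e A' →
              hamming A B ≡ hamming A' B → ∣ A ∣ ≡ ∣ A' ∣
  sameLevel (inj₁ a) (inj₁ a') eq = trans a (sym a')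
  sameLevel (inj₂ a) (inj₂ a') eq = trans a (sym a')
  sameLevel {A} {A'} {B} (inj₁ a) (inj₂ a') eq =
    ⊥-elim (consecutive-sizes-separated A A' B (trans a' (cong suc (sym a))) eq)
  sameLevel {A} {A'} {B} (inj₂ a) (inj₁ a') eq =
    ⊥-elim (consecutive-sizes-separated A' A B (trans a (cong suc (sym a'))) (sym eq))

  base : Vec Bool (2 * e)
  base = alternating (2 * e) false

  landmarks : List Ground
  landmarks = map (false ∷_) (prefixFlips base)

  landmarks-in-layers : All (InLayers e) landmarks
  landmarks-in-layers = map⁺ (All.map (λ where
      (inj₁ p) → inj₁ (trans p (alternating-size e))
      (inj₂ p) → inj₂ (trans p (cong suc (alternating-size e))))
    (prefixFlips-alternating₀ (2 * e)))

  landmarkVertices : List Vertex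
  landmarkVertices = toList landmarks-in-layers

  landmarks-length : length landmarkVertices ≤ suc (2 * e)
  landmarks-length = ≤-reflexive (begin
    length landmarkVertices ≡⟨ length-toList landmarks-in-layers ⟩
    length landmarks        ≡⟨ length-map (false ∷_) (prefixFlips base) ⟩
    length (prefixFlips base) ≡⟨ length-prefixFlips base ⟩
    suc (2 * e)             ∎)
    where open ≡-Reasoning

  -- Two vertices equidistant from all landmarks coincide: the tails agree by
  -- the prefix-flip argument, the first coordinates by the level parity.
  equidistant⇒≡ : (A A' : Ground) → InLayers e A → InLayers e A' →
                  All (λ B → hamming A B ≡ hamming A' B) landmarks → A ≡ A'
  equidistant⇒≡ (a ∷ As) (a' ∷ As') A-layer A'-layer eqs
    with prefixFlips-separate base As As' (bitDist a false) (bitDist a' false) (map⁻ eqs)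
  ... | refl = cong (_∷ As) (size-determines-head a a' As
                 (sameLevel {a ∷ As} {a' ∷ As} {false ∷ base} A-layer A'-layer (All-prefixFlips-head base (map⁻ eqs))))

  landmarks-resolving : Resolving (OddAdj e) landmarkVertices
  landmarks-resolving u v u≢v =
    let s , s∈S , ≢dist = find (¬All⇒Any¬ (λ s → dist u s ≟ dist v s) landmarkVertices
          (λ equidistant → u≢v (vertex-≡ u v (equidistant⇒≡ (proj₁ u) (proj₁ v)
             (proj₂ u) (proj₂ v) (All-toList⁻ landmarks-in-layers equidistant)))))
    in s , s∈S , _ , _ , isDist u s , isDist v s , ≢dist

-- The bound holds for every e.
theorem3p1 : (e : ℕ) → 2 ≤ e →
    MetricDimensionAtMost (OddAdj e) (suc (2 * e))
theorem3p1 e _ = landmarkVertices , landmarks-length , landmarks-resolving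
  where open DoubledOdd e
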